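{- Let $G=(V,E)$ be a graph with $n$ vertices, with modified adjacency matrix $A$ and initial-state vector $B$ as in the context, and suppose the system $AU=B$ has a solution over $\mathbb{F}_2$. Let $\mathrm{sol}$ be the value (number of ones) of the solution returned by Algorithm GreedyEchelon on input $(A,B)$. Then $\mathrm{sol}\le r$, where $r$ is the rank of $A$ over $\mathbb{F}_2$.
   Context: Generalized all-ones problem. Let $G=(V,E)$ be a graph with $V=\{v_1,\dots,v_n\}$. Each vertex carries a lamp (on or off) and a button of $\sigma^+$-type or $\sigma$-type. Pressing a $\sigma^+$-type button at $x$ toggles the lamps at $x$ and at all neighbours of $x$; pressing a $\sigma$-type button at $x$ toggles only the lamps at the neighbours of $x$. The modified adjacency matrix $A=(a_{ij})$ is the $n\times n$ matrix over $\mathbb{F}_2$ with, for $i\ne j$, $a_{ij}=1$ iff $v_iv_j\in E$, and $a_{ii}=1$ iff the button at $v_i$ is of $\sigma^+$-type. The vector $B=(b_1,\dots,b_n)^T\in\mathbb{F}_2^n$ has $b_i=1$ iff the lamp at $v_i$ is initially off. A solution is a vector $U\in\mathbb{F}_2^n$ with $AU=B$ (pressing the buttons at $\{v_i:u_i=1\}$ turns all lamps on); its value is its number of ones $\sum_i u_i$. Algorithm GreedyEchelon on input $(A,B)$: (1) Solve $AU=B$ over $\mathbb{F}_2$: if it has no solution, return "no solution"; otherwise compute a particular solution $\gamma$ and an $n\times m$ matrix $\eta$ whose columns form a basis of the null space of $A$, $m=n-\operatorname{rank}A$. If $m=0$ return $\gamma$. (2) Find an $n\times n$ permutation matrix $P$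 and an invertible $m\times m$ matrix $Q$ such that $\varepsilon=P\eta Q$ is in column echelon form: there are indices $0\le k_0<k_1<\dots<k_m=n$ such that rows $1,\dots,k_0$ of $\varepsilon$ are zero and, for each $i=1,\dots,m$, every row $j$ with $k_{i-1}<j\le k_i$ has $\varepsilon_{ji}=1$ and $\varepsilon_{jp}=0$ for all $p>i$. Set $\gamma'=P\gamma$. (3) For $i=1,\dots,m$ in order: for each $j$ with $k_{i-1}<j\le k_i$ let $c_j=\gamma'_j+\sum_{p<i}\varepsilon_{jp}z_p$ (over $\mathbb{F}_2$); if the number of $j$ in this range with $c_j=1$ is at most $(k_i-k_{i-1})/2$ set $z_i=0$, otherwise set $z_i=1$. (4) Return $U=P^{ -1}(\varepsilon z+\gamma')$, which is a solution of $AU=B$. -}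

module Defs where

open import Data.Bool using (Bool; true; false; _xor_; _∧_; if_then_else_)
open import Data.Nat using (ℕ; zero; suc; _+_; _*_; _≤_; _<_; _∸_; _≤ᵇ_; _<ᵇ_; _≟_)
open import Data.Fin using (Fin; toℕ; inject₁; fromℕ) renaming (zero to fzero; suc to fsuc)
open import Data.Empty using (⊥)
open import Relation.Nullary using (yes; no; ¬_)
open import Data.Fin.Permutation using (Permutation′; _⟨$⟩ʳ_; _⟨$⟩ˡ_)
open import Data.Product using (Σ; _×_; _,_)
open import Relation.Binary.PropositionalEquality using (_≡_)

-- The field F₂ is represented by Bool: addition = _xor_, multiplication = _∧_.

Vec₂ : ℕ → Set
Vec₂ n = Fin n → Bool

Mat₂ : ℕ → ℕ → Set
Mat₂ n m = Fin n → Fin m → Bool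

⊕-sum : ∀ {k} → (Fin k → Bool) → Bool
⊕-sum {zero}  f = false
⊕-sum {suc k} f = f fzero xor ⊕-sum (λ i → f (fsuc i))

count : ∀ {k} → (Fin k → Bool) → ℕ
count {zero}  f = 0
count {suc k} f = (if f fzero then 1 else 0) + count (λ i → f (fsuc i))

value : ∀ {n} → Vec₂ n → ℕ
value = count

_·_ : ∀ {n m} → Mat₂ n m → Vec₂ m → Vec₂ n
(M · x) i = ⊕-sum (λ j → M i j ∧ x j)

_⊗_ : ∀ {n m l} → Mat₂ n m → Mat₂ m l → Mat₂ n l
(M ⊗ N) i k = ⊕-sum (λ j → M i j ∧ N j k)

I₂ : ∀ {m} → Mat₂ m m
I₂ i j with toℕ i ≟ toℕ j
... | yes _ = true
... | no  _ = false

IsZero : ∀ {n} → Vec₂ n → Set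
IsZero x = ∀ i → x i ≡ false

IndependentColumns : ∀ {n s} → Mat₂ n s → Set
IndependentColumns {n} {s} M = (c : Vec₂ s) → IsZero (M · c) → IsZero c

selectCols : ∀ {n k s} → Mat₂ n k → (Fin s → Fin k) → Mat₂ n s
selectCols A f i t = A i (f t)

IsRank : ∀ {n k} → Mat₂ n k → ℕ → Set
IsRank {n} {k} A r =
  Σ (Fin r → Fin k) (λ f → IndependentColumns (selectCols A f))
  × (∀ s (f : Fin s → Fin k) → IndependentColumns (selectCols A f) → s ≤ r)

NullSpaceBasis : ∀ {n m} → Mat₂ n n → Mat₂ n m → Set
NullSpaceBasis {n} {m} A η =
  (∀ (l : Fin m) → IsZero (A · (λ i → η i l)))
  × IndependentColumns η
  × (∀ (x : Vec₂ n) → IsZero (A · x) → Σ (Vec₂ m) (λ c → ∀ i → (η · c) i ≡ x i))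

record LampGraph (n : ℕ) : Set where
  field
    adj       : Fin n → Fin n → Bool
    adj-sym   : ∀ i j → adj i j ≡ adj j i
    adj-irr   : ∀ i → adj i i ≡ false
    σ⁺-button : Fin n → Bool
    lamp-off  : Fin n → Bool

modAdj : ∀ {n} → LampGraph n → Mat₂ n n
modAdj G i j with toℕ i ≟ toℕ j
... | yes _ = LampGraph.σ⁺-button G i
... | no  _ = LampGraph.adj G i j

initB : ∀ {n} → LampGraph n → Vec₂ n
initB G = LampGraph.lamp-off G

-- Applying the permutation matrix P (given by the permutation π) to a vector,
-- and its inverse P⁻¹.
permV : ∀ {n} → Permutation′ n → Vec₂ n → Vec₂ n
permV π x j = x (π ⟨$⟩ʳ j)

permV⁻¹ : ∀ {n} → Permutation′ n → Vec₂ n → Vec₂ n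
permV⁻¹ π x i = x (π ⟨$⟩ˡ i)

permM : ∀ {n m} → Permutation′ n → Mat₂ n m → Mat₂ n m
permM π M j l = M (π ⟨$⟩ʳ j) l

Invertible : ∀ {m} → Mat₂ m m → Set
Invertible {m} Q = Σ (Mat₂ m m) (λ Q' → (∀ i j → (Q ⊗ Q') i j ≡ I₂ i j) × (∀ i j → (Q' ⊗ Q) i j ≡ I₂ i j))

-- Indices are 0-based: k (inject₁ i) = k_{i}, k (suc i) = k_{i+1} for i : Fin m,
-- (paper column i+1), and row j : Fin n is paper row toℕ j + 1.
-- Block of column i: rows j with k_{i} < toℕ j + 1 ≤ k_{i+1}, i.e. k_i ≤ toℕ j < k_{i+1}.
InBlock : ∀ {m} → (Fin (suc m) → ℕ) → Fin m → ℕ → Set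
InBlock k i j = k (inject₁ i) ≤ j × j < k (fsuc i)

inBlockᵇ : ∀ {m} → (Fin (suc m) → ℕ) → Fin m → ℕ → Bool
inBlockᵇ k i j = (k (inject₁ i) ≤ᵇ j) ∧ (j <ᵇ k (fsuc i))

ColumnEchelon : ∀ {n m} → Mat₂ n m → (Fin (suc m) → ℕ) → Set
ColumnEchelon {n} {m} ε k =
  (∀ (i : Fin m) → k (inject₁ i) < k (fsuc i))
  × k (fromℕ m) ≡ n
  × (∀ (j : Fin n) (p : Fin m) → toℕ j < k fzero → ε j p ≡ false)
  × (∀ (i : Fin m) (j : Fin n) → InBlock k i (toℕ j) →
       ε j i ≡ true × (∀ (p : Fin m) → toℕ i < toℕ p → ε j p ≡ false))

cval : ∀ {n m} → Vec₂ n → Mat₂ n m → Vec₂ m → Fin m → Fin n → Bool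
cval γ' ε z i j = γ' j xor ⊕-sum (λ p → (toℕ p <ᵇ toℕ i) ∧ (ε j p ∧ z p))

GreedyChoice : ∀ {n m} → Vec₂ n → Mat₂ n m → (Fin (suc m) → ℕ) → Vec₂ m → Set
GreedyChoice γ' ε k z =
  ∀ i → let cnt = count (λ j → inBlockᵇ k i (toℕ j) ∧ cval γ' ε z i j)
            s   = k (fsuc i) ∸ k (inject₁ i)
        in (2 * cnt ≤ s → z i ≡ false) × (¬ (2 * cnt ≤ s) → z i ≡ true)

greedyOutput : ∀ {n m} → Permutation′ n → Mat₂ n m → Vec₂ m → Vec₂ n → Vec₂ n
greedyOutput π ε z γ' = permV⁻¹ π (λ j → (ε · z) j xor γ' j)

{-# OPTIONS --safe #-}
-- Let u′ = εz + γ′, so that U = P⁻¹u′. On the block of column i the echelon form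
-- gives u′_j = z_i + c_j, so the block holds #{c_j = 1} ones if z_i = 0 and
-- #{c_j = 0} ones if z_i = 1; the greedy choice makes this strictly less than the
-- block width k_i − k_{i−1}. The rows before k₀ hold at most k₀ ones, so u′ has at
-- most k₀ + Σᵢ (k_i − k_{i−1} − 1) = n − m = r ones, and P⁻¹ preserves the count.
module Submission where

open import Defs
open import Data.Nat using (ℕ; suc; _≤_; _∸_)
open import Data.Fin using (Fin)
open import Data.Fin.Permutation using (Permutation′)
open import Relation.Binary.PropositionalEquality using (_≡_)

open import Algebra.Bundles using (CommutativeRing)
open import Data.Bool using (Bool; true; false; _xor_; _∧_; not; if_then_else_; T)
open import Data.Bool.Properties using (T-∧; T-≡; xor-∧-commutativeRing)
open import Data.Nat using (zero; _+_; _*_; _<_; _≤ᵇ_; _<ᵇ_; _⊔_; z≤n; z<s; s<s; _≤?_; _<?_)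
open import Data.Nat.Properties
open import Data.Nat.Tactic.RingSolver using (solve-∀)
open import Data.Fin using (toℕ; inject₁; fromℕ) renaming (zero to fzero; suc to fsuc)
open import Data.Fin.Induction using (<-weakInduction)
open import Data.Fin.Properties using (toℕ-inject₁; toℕ-fromℕ; toℕ<n)
open import Data.Fin.Permutation using (_⟨$⟩ˡ_; flip)
open import Data.Product using (_×_; _,_; proj₁; proj₂)
open import Data.Unit using (tt)
open import Function using (_∘_; Equivalence)
open import Relation.Binary.PropositionalEquality using (_≗_; refl; sym; trans; cong; cong₂; subst; subst₂; module ≡-Reasoning)
open import Relation.Nullary using (¬_; yes; no)
open import Relation.Nullary.Decidable using (dec-true; dec-false)

open import Algebra.Properties.CommutativeMonoid.Sum +-0-commutativeMonoid
  using (sum; sum-cong-≗; ∑-distrib-+; sum-permute)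
open import Algebra.Properties.CommutativeSemigroup
  (CommutativeRing.+-commutativeSemigroup xor-∧-commutativeRing)
  using (x∙yz≈y∙xz; xy∙z≈x∙zy)

indicator : Bool → ℕ
indicator b = if b then 1 else 0

count-cong : ∀ {n} {f g : Fin n → Bool} → f ≗ g → count f ≡ count g
count-cong {zero}  f≗g = refl
count-cong {suc n} f≗g = cong₂ _+_ (cong indicator (f≗g fzero)) (count-cong (f≗g ∘ fsuc))

count-mono : ∀ {n} {f g : Fin n → Bool} → (∀ j → T (f j) → T (g j)) → count f ≤ count g
count-mono {zero}  f⇒g = z≤n
count-mono {suc n} f⇒g = +-mono-≤ (indicator-mono (f⇒g fzero)) (count-mono (f⇒g ∘ fsuc))
  where
  indicator-mono : ∀ {a b} → (T a → T b) → indicator a ≤ indicator b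
  indicator-mono {false}         _   = z≤n
  indicator-mono {true} {true}   _   = ≤-refl
  indicator-mono {true} {false}  a⇒b with () ← a⇒b tt

count≡sum : ∀ {n} (f : Fin n → Bool) → count f ≡ sum (indicator ∘ f)
count≡sum {zero}  f = refl
count≡sum {suc n} f = cong (indicator (f fzero) +_) (count≡sum (f ∘ fsuc))

count-split : ∀ {n} {h f g : Fin n → Bool} →
              (∀ j → indicator (h j) ≡ indicator (f j) + indicator (g j)) →
              count h ≡ count f + count g
count-split {h = h} {f} {g} split = begin
  count h                                       ≡⟨ count≡sum h ⟩
  sum (indicator ∘ h)                           ≡⟨ sum-cong-≗ split ⟩
  sum (λ j → indicator (f j) + indicator (g j)) ≡⟨ ∑-distrib-+ (indicator ∘ f) (indicator ∘ g) ⟩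
  sum (indicator ∘ f) + sum (indicator ∘ g)     ≡⟨ cong₂ _+_ (count≡sum f) (count≡sum g) ⟨
  count f + count g                             ∎
  where open ≡-Reasoning

count-permute : ∀ {n} (π : Permutation′ n) (f : Fin n → Bool) → count (f ∘ (π ⟨$⟩ˡ_)) ≡ count f
count-permute π f = begin
  count (f ∘ (π ⟨$⟩ˡ_))           ≡⟨ count≡sum (f ∘ (π ⟨$⟩ˡ_)) ⟩
  sum (indicator ∘ f ∘ (π ⟨$⟩ˡ_)) ≡⟨ sum-permute (indicator ∘ f) (flip π) ⟨
  sum (indicator ∘ f)             ≡⟨ count≡sum f ⟨
  count f                         ∎
  where open ≡-Reasoning

inRangeᵇ : ℕ → ℕ → ℕ → Bool
inRangeᵇ a b x = (a ≤ᵇ x) ∧ (x <ᵇ b)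

T-inRangeᵇ : ∀ {a b x} → T (inRangeᵇ a b x) → a ≤ x × x < b
T-inRangeᵇ {a} {b} {x} t with a≤x , x<b ← Equivalence.to T-∧ t = ≤ᵇ⇒≤ a x a≤x , <ᵇ⇒< x b x<b

indicator-inRangeᵇ-step : ∀ a b o → indicator (inRangeᵇ a b o) + (b ∸ (a ⊔ suc o)) ≤ b ∸ (a ⊔ o)
indicator-inRangeᵇ-step a b o with a ≤? o
... | no a≰o
  rewrite dec-false (a ≤? o) a≰o | m≥n⇒m⊔n≡m (≰⇒> a≰o) | m≥n⇒m⊔n≡m (<⇒≤ (≰⇒> a≰o)) = ≤-refl
... | yes a≤o
  rewrite dec-true (a ≤? o) a≤o | m≤n⇒m⊔n≡n (m≤n⇒m≤1+n a≤o) | m≤n⇒m⊔n≡n a≤o with o <? b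
...   | yes o<b rewrite dec-true (o <? b) o<b = ≤-reflexive (sym (+-∸-assoc 1 o<b))
...   | no o≮b rewrite dec-false (o <? b) o≮b = ∸-monoʳ-≤ b (n≤1+n o)

count-inRangeᵇ-from : ∀ {n} a b o → count {n} (λ j → inRangeᵇ a b (o + toℕ j)) ≤ b ∸ (a ⊔ o)
count-inRangeᵇ-from {zero}  a b o = z≤n
count-inRangeᵇ-from {suc n} a b o rewrite +-identityʳ o = begin
  indicator (inRangeᵇ a b o) + count {n} (λ j → inRangeᵇ a b (o + suc (toℕ j)))
    ≡⟨ cong (indicator (inRangeᵇ a b o) +_) (count-cong {n} (λ j → cong (inRangeᵇ a b) (+-suc o (toℕ j)))) ⟩
  indicator (inRangeᵇ a b o) + count {n} (λ j → inRangeᵇ a b (suc o + toℕ j))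
    ≤⟨ +-monoʳ-≤ (indicator (inRangeᵇ a b o)) (count-inRangeᵇ-from {n} a b (suc o)) ⟩
  indicator (inRangeᵇ a b o) + (b ∸ (a ⊔ suc o))
    ≤⟨ indicator-inRangeᵇ-step a b o ⟩
  b ∸ (a ⊔ o) ∎
  where open ≤-Reasoning

count-inRangeᵇ : ∀ {n} a b → count {n} (λ j → inRangeᵇ a b (toℕ j)) ≤ b ∸ a
count-inRangeᵇ {n} a b =
  subst (λ c → count {n} (λ j → inRangeᵇ a b (toℕ j)) ≤ b ∸ c) (⊔-identityʳ a) (count-inRangeᵇ-from {n} a b 0)

count-below : ∀ {n} t (f : Fin n → Bool) → count (λ j → (toℕ j <ᵇ t) ∧ f j) ≤ t
count-below {n} t f =
  ≤-trans (count-mono {n} {g = λ j → inRangeᵇ 0 t (toℕ j)} (λ j → proj₁ ∘ Equivalence.to T-∧))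
          (count-inRangeᵇ {n} 0 t)

indicator-∧-split : ∀ a b → indicator a ≡ indicator (a ∧ not b) + indicator (a ∧ b)
indicator-∧-split false b     = refl
indicator-∧-split true  false = refl
indicator-∧-split true  true  = refl

indicator-<ᵇ-split : ∀ {a b} → a ≤ b → ∀ x v →
  indicator ((x <ᵇ b) ∧ v) ≡ indicator ((x <ᵇ a) ∧ v) + indicator (inRangeᵇ a b x ∧ v)
indicator-<ᵇ-split {a} {b} a≤b x v with x <? a
... | yes x<a
  rewrite dec-true (x <? a) x<a | dec-false (a ≤? x) (<⇒≱ x<a) | dec-true (x <? b) (<-≤-trans x<a a≤b)
  = sym (+-identityʳ _)
... | no x≮a rewrite dec-false (x <? a) x≮a | dec-true (a ≤? x) (≮⇒≥ x≮a) = refl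

⊕-sum-false : ∀ {m} (f : Fin m → Bool) → (∀ p → f p ≡ false) → ⊕-sum f ≡ false
⊕-sum-false {zero}  f f≡false = refl
⊕-sum-false {suc m} f f≡false rewrite f≡false fzero = ⊕-sum-false (f ∘ fsuc) (f≡false ∘ fsuc)

⊕-sum-vanishing-above : ∀ {m} (f : Fin m → Bool) (i : Fin m) →
                        (∀ p → toℕ i < toℕ p → f p ≡ false) →
                        ⊕-sum f ≡ f i xor ⊕-sum (λ p → (toℕ p <ᵇ toℕ i) ∧ f p)
⊕-sum-vanishing-above {suc m} f fzero above = cong (f fzero xor_) (begin
  ⊕-sum (f ∘ fsuc)        ≡⟨ ⊕-sum-false (f ∘ fsuc) (λ p → above (fsuc p) z<s) ⟩
  false                   ≡⟨ ⊕-sum-false {m} (λ _ → false) (λ _ → refl) ⟨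
  ⊕-sum {m} (λ _ → false) ∎)
  where open ≡-Reasoning
⊕-sum-vanishing-above {suc m} f (fsuc i) above = begin
  f fzero xor ⊕-sum (f ∘ fsuc)       ≡⟨ cong (f fzero xor_) (⊕-sum-vanishing-above (f ∘ fsuc) i
                                                                (λ p → above (fsuc p) ∘ s<s)) ⟩
  f fzero xor (f (fsuc i) xor below) ≡⟨ x∙yz≈y∙xz (f fzero) (f (fsuc i)) below ⟩
  f (fsuc i) xor (f fzero xor below) ∎
  where
  open ≡-Reasoning
  below : Bool
  below = ⊕-sum (λ p → (toℕ p <ᵇ toℕ i) ∧ f (fsuc p))

2*m≤n⇒m<n : ∀ {m n} → 2 * m ≤ n → 0 < n → m < n
2*m≤n⇒m<n {zero}  _    0<n = 0<n
2*m≤n⇒m<n {suc m} 2m≤n _   = <-≤-trans (m<m+n (suc m) z<s) 2m≤n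

module GreedyEchelon
  {n m} (ε : Mat₂ n m) (γ′ : Vec₂ n) (k : Fin (suc m) → ℕ) (z : Vec₂ m)
  (k-increasing : ∀ i → k (inject₁ i) < k (fsuc i))
  (k-last : k (fromℕ m) ≡ n)
  (block-pattern : ∀ i j → InBlock k i (toℕ j) →
                   ε j i ≡ true × (∀ p → toℕ i < toℕ p → ε j p ≡ false))
  (greedy : GreedyChoice γ′ ε k z)
  where

  U′ : Vec₂ n
  U′ j = (ε · z) j xor γ′ j

  inBlock : Fin m → Fin n → Bool
  inBlock i j = inBlockᵇ k i (toℕ j)

  width : Fin m → ℕ
  width i = k (fsuc i) ∸ k (inject₁ i)

  c : Fin m → Fin n → Bool
  c = cval γ′ ε z

  U′-on-block : ∀ i j → T (inBlock i j) → U′ j ≡ z i xor c i j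
  U′-on-block i j j∈i with ε-pivot , ε-right ← block-pattern i j (T-inRangeᵇ j∈i) = begin
    (ε · z) j xor γ′ j                   ≡⟨ cong (_xor γ′ j) (⊕-sum-vanishing-above (λ p → ε j p ∧ z p) i
                                              (λ p i<p → cong (_∧ z p) (ε-right p i<p))) ⟩
    ((ε j i ∧ z i) xor earlier) xor γ′ j ≡⟨ cong (λ e → ((e ∧ z i) xor earlier) xor γ′ j) ε-pivot ⟩
    (z i xor earlier) xor γ′ j           ≡⟨ xy∙z≈x∙zy (z i) earlier (γ′ j) ⟩
    z i xor c i j                        ∎
    where
    open ≡-Reasoning
    earlier : Bool
    earlier = ⊕-sum (λ p → (toℕ p <ᵇ toℕ i) ∧ (ε j p ∧ z p))

  c-ones : Fin m → ℕ
  c-ones i = count (λ j → inBlock i j ∧ c i j)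

  greedy-false : ∀ {i} → z i ≡ false → 2 * c-ones i ≤ width i
  greedy-false {i} zᵢ≡false with 2 * c-ones i ≤? width i
  ... | yes 2oᵢ≤wᵢ = 2oᵢ≤wᵢ
  ... | no  2oᵢ≰wᵢ with () ← trans (sym zᵢ≡false) (proj₂ (greedy i) 2oᵢ≰wᵢ)

  greedy-true : ∀ {i} → z i ≡ true → ¬ (2 * c-ones i ≤ width i)
  greedy-true {i} zᵢ≡true 2oᵢ≤wᵢ with () ← trans (sym zᵢ≡true) (proj₁ (greedy i) 2oᵢ≤wᵢ)

  c-ones-positive : ∀ {i} → z i ≡ true → 0 < c-ones i
  c-ones-positive {i} zᵢ≡true =
    n≢0⇒n>0 (λ oᵢ≡0 → greedy-true zᵢ≡true (subst (λ o → 2 * o ≤ width i) (sym oᵢ≡0) z≤n))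

  inBlock-∧-U′ : ∀ i j → (inBlock i j ∧ U′ j) ≡ (inBlock i j ∧ (z i xor c i j))
  inBlock-∧-U′ i j with inBlock i j in j∈i
  ... | false = refl
  ... | true  = U′-on-block i j (Equivalence.from T-≡ j∈i)

  U′-ones-in-block<width : ∀ i → count (λ j → inBlock i j ∧ U′ j) < width i
  U′-ones-in-block<width i rewrite count-cong (inBlock-∧-U′ i) with z i in zᵢ
  ... | false = 2*m≤n⇒m<n (greedy-false zᵢ) (m<n⇒0<n∸m (k-increasing i))
  ... | true  = begin-strict
    count (λ j → inBlock i j ∧ not (c i j))            <⟨ m<m+n _ (c-ones-positive zᵢ) ⟩
    count (λ j → inBlock i j ∧ not (c i j)) + c-ones i ≡⟨ count-split (λ j → indicator-∧-split (inBlock i j) (c i j)) ⟨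
    count (inBlock i)                                  ≤⟨ count-inRangeᵇ {n} (k (inject₁ i)) (k (fsuc i)) ⟩
    width i                                            ∎
    where open ≤-Reasoning

  U′-ones-below : ℕ → ℕ
  U′-ones-below t = count (λ j → (toℕ j <ᵇ t) ∧ U′ j)

  U′-ones-below-step : ∀ i → U′-ones-below (k (fsuc i)) ≡
                             U′-ones-below (k (inject₁ i)) + count (λ j → inBlock i j ∧ U′ j)
  U′-ones-below-step i = count-split (λ j → indicator-<ᵇ-split (<⇒≤ (k-increasing i)) (toℕ j) (U′ j))

  U′-ones-below-k+t≤k : ∀ t → U′-ones-below (k t) + toℕ t ≤ k t
  U′-ones-below-k+t≤k = <-weakInduction (λ t → U′-ones-below (k t) + toℕ t ≤ k t) base step
    where
    base : U′-ones-below (k fzero) + 0 ≤ k fzero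
    base = subst (_≤ k fzero) (sym (+-identityʳ _)) (count-below (k fzero) U′)

    step : ∀ i → U′-ones-below (k (inject₁ i)) + toℕ (inject₁ i) ≤ k (inject₁ i) →
                 U′-ones-below (k (fsuc i)) + suc (toℕ i) ≤ k (fsuc i)
    step i ih = begin
      U′-ones-below b + suc (toℕ i)          ≡⟨ cong (_+ suc (toℕ i)) (U′-ones-below-step i) ⟩
      U′-ones-below a + inside + suc (toℕ i) ≡⟨ swap (U′-ones-below a) inside (toℕ i) ⟩
      U′-ones-below a + toℕ i + suc inside   ≤⟨ +-mono-≤ ih′ (U′-ones-in-block<width i) ⟩
      a + (b ∸ a)                            ≡⟨ m+[n∸m]≡n (<⇒≤ (k-increasing i)) ⟩
      b                                      ∎
      where
      open ≤-Reasoning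
      a b inside : ℕ
      a = k (inject₁ i)
      b = k (fsuc i)
      inside = count (λ j → inBlock i j ∧ U′ j)
      ih′ : U′-ones-below a + toℕ i ≤ a
      ih′ = subst (λ t → U′-ones-below a + t ≤ a) (toℕ-inject₁ i) ih
      swap : ∀ x y u → x + y + suc u ≡ x + u + suc y
      swap = solve-∀

  count-U′+m≤n : count U′ + m ≤ n
  count-U′+m≤n = subst₂ _≤_ (cong₂ _+_ U′-ones-below-n (toℕ-fromℕ m)) k-last (U′-ones-below-k+t≤k (fromℕ m))
    where
    U′-ones-below-n : U′-ones-below (k (fromℕ m)) ≡ count U′
    U′-ones-below-n rewrite k-last = count-cong (λ j → cong (_∧ U′ j) (dec-true (toℕ j <? n) (toℕ<n j)))

+∸≤⇒≤ : ∀ {x n r} → x + (n ∸ r) ≤ n → x ≤ r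
+∸≤⇒≤ {x} {n} {r} x+[n∸r]≤n with r ≤? n
... | yes r≤n = subst (x ≤_) (m∸[m∸n]≡n r≤n) (m+n≤o⇒m≤o∸n x x+[n∸r]≤n)
... | no  r≰n = ≤-trans (≤-trans (m≤m+n x (n ∸ r)) x+[n∸r]≤n) (<⇒≤ (≰⇒> r≰n))

proposition4 :
  ∀ {n : ℕ} (G : LampGraph n) (r : ℕ) → IsRank (modAdj G) r →
  (γ : Vec₂ n) → (∀ i → (modAdj G · γ) i ≡ initB G i) →
  (m : ℕ) (η : Mat₂ n m) → NullSpaceBasis (modAdj G) η → m ≡ n ∸ r →
  (π : Permutation′ n) (Q : Mat₂ m m) → Invertible Q →
  (k : Fin (suc m) → ℕ) → ColumnEchelon (permM π η ⊗ Q) k →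
  (z : Vec₂ m) → GreedyChoice (permV π γ) (permM π η ⊗ Q) k z →
  value (greedyOutput π (permM π η ⊗ Q) z (permV π γ)) ≤ r
-- Solvability, rank and the null-space basis enter only through m ≡ n ∸ r: the bound
-- n − m holds for every matrix in column echelon form and every greedy choice.
proposition4 G r _ γ _ m η _ m≡n∸r π Q _ k (k-increasing , k-last , _ , block-pattern) z greedy = begin
  value (permV⁻¹ π U′) ≡⟨ count-permute π U′ ⟩
  count U′             ≤⟨ +∸≤⇒≤ (subst (λ m → count U′ + m ≤ _) m≡n∸r count-U′+m≤n) ⟩
  r                    ∎
  where
  open GreedyEchelon (permM π η ⊗ Q) (permV π γ) k z k-increasing k-last block-pattern greedy
  open ≤-Reasoning
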